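{- Let $r=r(z)$ be the power series $$r=\frac{1-z^4-z^2-\sqrt{z^8-2z^6-z^4-2z^2+1}}{2z^3}.$$ For $k\ge 0$ let $f_k(z)$ (resp. $g_k(z)$) be the generating function whose coefficient of $z^n$ is the number of partial zigzag knight's paths of size $n$ ending at height $k$ whose last step is an up-step $N$ or $E$ (resp. a down-step $\bar N$ or $\bar E$), where the empty path is counted in $f_0$. Let $F(u)=\sum_{k\ge0}u^kf_k(z)$ and $G(u)=\sum_{k\ge0}u^kg_k(z)$. Then $$F(u)=\frac{ru(u+z)}{z^2(1-ru)}+1,\qquad G(u)=\frac{r}{z^3(1-ru)}-1,\qquad F(u)+G(u)=\frac{ru^2z+ruz^2+r}{z^3(1-ru)}.$$ Moreover, $f_0=1$; $f_k=\frac{rz+1}{z^2}r^{k-1}-[k=1]\frac{1}{z^2}$ for $k\ge1$; $g_0=\frac{r}{z^3}-1$; and $g_k=\frac{r^{k+1}}{z^3}$ for $k\ge1$, where $[k=1]$ equals $1$ if $k=1$ and $0$ otherwise.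
   Context: Let $N=(1,2)$, $\bar N=(1,-2)$, $E=(2,1)$, $\bar E=(2,-1)$; $N,E$ are up-steps and $\bar N,\bar E$ are down-steps. A knight's path is a lattice path in $\mathbb N^2$ starting at $(0,0)$, ending on the $x$-axis, with steps in $\{N,\bar N,E,\bar E\}$. A zigzag knight's path is a knight's path in which consecutive steps alternate between up-steps and down-steps (two consecutive steps $(a,b),(c,d)$ satisfy $bd<0$). A partial zigzag knight's path is a prefix (possibly empty) of a zigzag knight's path. The size of a path is the abscissa of its last point; the height of a point is its ordinate. -}

module Defs where

open import Data.Nat as ℕ using (ℕ; zero; suc; _∸_)
open import Data.Integer as ℤ using (ℤ; +_; -[1+_]; _+_; _*_; -_; _-_; _≤_)
open import Data.List using (List; []; _∷_; _++_; _∷ʳ_; length; map)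
open import Data.Nat.ListAction using (sum)
open import Data.Bool using (Bool; true; false; not)
open import Data.Product using (Σ; ∃; ∃₂; _×_; _,_)
open import Data.Unit using (⊤)
open import Relation.Binary.PropositionalEquality using (_≡_)
open import Data.List.Relation.Unary.Unique.Propositional using (Unique)
open import Data.List.Membership.Propositional using (_∈_)

data Step : Set where
  N N̄ E Ē : Step

dx : Step → ℕ
dx N = 1
dx N̄ = 1
dx E = 2
dx Ē = 2

dy : Step → ℤ
dy N = + 2
dy N̄ = - (+ 2)
dy E = + 1
dy Ē = - (+ 1)

up : Step → Bool
up N = true
up N̄ = false
up E = true
up Ē = false

-- starting at height h, every visited point has nonnegative height
-- (abscissas are automatically nonnegative), i.e. the path lies in ℕ²
Valid : ℤ → List Step → Set
Valid h [] = ⊤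
Valid h (s ∷ p) = (+ 0 ≤ h + dy s) × Valid (h + dy s) p

endHeight : ℤ → List Step → ℤ
endHeight h [] = h
endHeight h (s ∷ p) = endHeight (h + dy s) p

-- size = abscissa of the last point
size : List Step → ℕ
size p = sum (map dx p)

Alternating : List Step → Set
Alternating [] = ⊤
Alternating (s ∷ []) = ⊤
Alternating (s ∷ t ∷ p) = (up s ≡ not (up t)) × Alternating (t ∷ p)

KnightPath : List Step → Set
KnightPath p = Valid (+ 0) p × (endHeight (+ 0) p ≡ + 0)

ZigzagKnightPath : List Step → Set
ZigzagKnightPath p = KnightPath p × Alternating p

PartialZigzag : List Step → Set
PartialZigzag p = ∃ λ q → ZigzagKnightPath (p ++ q)

LastUp : List Step → Set
LastUp p = ∃₂ λ q s → (p ≡ q ∷ʳ s) × (up s ≡ true)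

LastDown : List Step → Set
LastDown p = ∃₂ λ q s → (p ≡ q ∷ʳ s) × (up s ≡ false)

IsCount : (List Step → Set) → ℕ → Set
IsCount P m = Σ (List (List Step)) λ L →
  (length L ≡ m) × Unique L × (∀ p → (p ∈ L → P p) × (P p → p ∈ L))

FPaths : ℕ → ℕ → List Step → Set
FPaths k n p = PartialZigzag p × (size p ≡ n) × (endHeight (+ 0) p ≡ + k)
               × (LastUp p Data.Sum.⊎ (p ≡ []))
  where import Data.Sum

GPaths : ℕ → ℕ → List Step → Set
GPaths k n p = PartialZigzag p × (size p ≡ n) × (endHeight (+ 0) p ≡ + k)
               × LastDown p

PS : Set
PS = ℕ → ℤ

sumTo : ℕ → (ℕ → ℤ) → ℤ
sumTo zero f = f 0
sumTo (suc n) f = sumTo n f + f (suc n)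

_≈_ : PS → PS → Set
f ≈ g = ∀ n → f n ≡ g n

infix 4 _≈_ _≈₂_
infixl 6 _⊕_ _⊖_ _⊕₂_ _⊖₂_
infixl 7 _⊛_ _⊛₂_

_⊕_ : PS → PS → PS
(f ⊕ g) n = f n + g n

_⊖_ : PS → PS → PS
(f ⊖ g) n = f n - g n

_⊛_ : PS → PS → PS
(f ⊛ g) n = sumTo n (λ i → f i * g (n ∸ i))

poly : List ℤ → PS
poly [] n = + 0
poly (c ∷ cs) zero = c
poly (c ∷ cs) (suc n) = poly cs n

cst : ℤ → PS
cst c = poly (c ∷ [])

mono : ℤ → ℕ → PS
mono c zero = cst c
mono c (suc d) zero = + 0
mono c (suc d) (suc n) = mono c d n

z^ : ℕ → PS
z^ d = mono (+ 1) d

_^ˢ_ : PS → ℕ → PS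
f ^ˢ zero = cst (+ 1)
f ^ˢ suc k = f ⊛ (f ^ˢ k)

Apoly : PS
Apoly = poly (+ 1 ∷ + 0 ∷ - (+ 1) ∷ + 0 ∷ - (+ 1) ∷ [])

Dpoly : PS
Dpoly = poly (+ 1 ∷ + 0 ∷ - (+ 2) ∷ + 0 ∷ - (+ 1) ∷ + 0 ∷ - (+ 2) ∷ + 0 ∷ + 1 ∷ [])

IsSqrtD : PS → Set
IsSqrtD s = (s 0 ≡ + 1) × (s ⊛ s ≈ Dpoly)

-- r = (A - s) / (2 z^3), i.e. 2 z^3 r = A - s
IsR : PS → PS → Set
IsR s r = IsSqrtD s × (mono (+ 2) 3 ⊛ r ≈ Apoly ⊖ s)

-- Bivariate series in u, z: B k n = coefficient of u^k z^n

BPS : Set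
BPS = ℕ → ℕ → ℤ

_≈₂_ : BPS → BPS → Set
F ≈₂ G = ∀ k n → F k n ≡ G k n

_⊕₂_ : BPS → BPS → BPS
(F ⊕₂ G) k n = F k n + G k n

_⊖₂_ : BPS → BPS → BPS
(F ⊖₂ G) k n = F k n - G k n

_⊛₂_ : BPS → BPS → BPS
(F ⊛₂ G) k n = sumTo k (λ i → (F i ⊛ G (k ∸ i)) n)

-- h(z) u^d
uMono : PS → ℕ → BPS
uMono h zero zero = h
uMono h zero (suc k) = λ _ → + 0
uMono h (suc d) zero = λ _ → + 0
uMono h (suc d) (suc k) = uMono h d k

lift : PS → BPS
lift h = uMono h 0

genFun : (ℕ → ℕ → ℕ) → BPS
genFun f k n = + (f k n)

-- the Iverson bracket [k = 1] for k = suc j, i.e. [j = 0]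
iv0 : ℕ → ℤ
iv0 zero = + 1
iv0 (suc j) = + 0

-- A path is a partial zigzag knight's path iff it stays in ℕ² and alternates, since such a
-- path can always be brought back to the axis by the steps Ē and E N̄. Classify these paths
-- by height k and direction of the last step, the empty path counting as ending downwards,
-- and let U_k and D_k be the corresponding counting series. Removing the last step gives
--   U_k = z D_{k−2} + z² D_{k−1},    D_k = [k = 0] + z U_{k+2} + z² U_{k+1},
-- so H_k = z³ D_k satisfies the kernel equation
--   (1 − z² − z⁴) H_k = z³ (H_{k+1} + H_{k−1}),    H_{−1} = 1,
-- and so do the powers r^{k+1} exactly when z³ r² − (1 − z² − z⁴) r + z³ = 0, which is what
-- the formula for r says. The kernel equation can be written H = z · Φ(H) with Φ causal,
-- hence has at most one solution: z³ D_k = r^{k+1}, and the rest is algebra. Such an r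
-- exists, namely H_0: both H_{k+1} and H_0 H_k solve the kernel equation with boundary
-- value H_0, so H_1 = H_0².

module Submission where

open import Defs
open import Data.Nat as ℕ using (ℕ; zero; suc; _∸_; z≤n; s≤s)
import Data.Nat.Properties as ℕP
open import Data.Integer as ℤ using (ℤ; +_; -[1+_]; _+_; _*_; -_; _-_)
import Data.Integer.Properties as ℤP
open import Data.List using (List; []; _∷_; _++_; _∷ʳ_; map; length; initLast; _∷ʳ′_)
import Data.List.Properties as LP
open import Data.Nat.ListAction using (sum)
open import Data.Nat.ListAction.Properties using (sum-++)
open import Data.Bool using (Bool; true; false; not)
open import Data.Unit using (⊤; tt)
open import Data.Maybe using (Maybe; just; nothing)
open import Data.Product using (Σ; ∃; ∃₂; _×_; _,_; proj₁; proj₂)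
open import Data.Sum using (_⊎_; inj₁; inj₂)
open import Data.List.Membership.Propositional using (_∈_; _─_)
open import Data.List.Membership.Propositional.Properties
  using (∈-map⁻; ∈-map⁺; ∈-++⁻; ∈-++⁺ˡ; ∈-++⁺ʳ)
import Data.List.Relation.Unary.Any as Any
open import Data.List.Relation.Unary.Any using (here; there)
open import Data.List.Relation.Unary.Unique.Propositional using (Unique)
import Data.List.Relation.Unary.Unique.Propositional.Properties as Unique
open import Data.List.Relation.Unary.AllPairs using ([]; _∷_)
open import Data.List.Relation.Unary.All using (All; []; _∷_)
open import Data.Empty using (⊥; ⊥-elim)
open import Function using (_∘_)
open import Relation.Binary.PropositionalEquality
open import Relation.Nullary using (yes; no)
open import Level using (0ℓ)
open import Relation.Binary.Structures using (IsEquivalence)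
open import Algebra.Structures.Biased using (IsCommutativeSemiringˡ)
open import Algebra.Solver.Ring.AlmostCommutativeRing
import Relation.Binary.Reasoning.Setoid
open import Algebra.Properties.CommutativeSemigroup ℤP.+-commutativeSemigroup using (interchange)
open import Algebra.Properties.AbelianGroup ℤP.+-0-abelianGroup using () renaming (∙-cancelˡ to +-cancelˡ)

sumTo-cong : ∀ n {f g : ℕ → ℤ} → (∀ i → i ℕ.≤ n → f i ≡ g i) → sumTo n f ≡ sumTo n g
sumTo-cong zero    f≗g = f≗g 0 z≤n
sumTo-cong (suc n) f≗g =
  cong₂ _+_ (sumTo-cong n (λ i i≤n → f≗g i (ℕP.m≤n⇒m≤1+n i≤n))) (f≗g (suc n) ℕP.≤-refl)

sumTo-+ : ∀ n (f g : ℕ → ℤ) → sumTo n (λ i → f i + g i) ≡ sumTo n f + sumTo n g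
sumTo-+ zero    f g = refl
sumTo-+ (suc n) f g =
  trans (cong (_+ (f (suc n) + g (suc n))) (sumTo-+ n f g))
        (interchange (sumTo n f) (sumTo n g) (f (suc n)) (g (suc n)))

sumTo-*ˡ : ∀ n c (f : ℕ → ℤ) → sumTo n (λ i → c * f i) ≡ c * sumTo n f
sumTo-*ˡ zero    c f = refl
sumTo-*ˡ (suc n) c f =
  trans (cong (_+ c * f (suc n)) (sumTo-*ˡ n c f)) (sym (ℤP.*-distribˡ-+ c (sumTo n f) (f (suc n))))

sumTo-neg : ∀ n (f : ℕ → ℤ) → sumTo n (λ i → - f i) ≡ - sumTo n f
sumTo-neg zero    f = refl
sumTo-neg (suc n) f =
  trans (cong (_+ - f (suc n)) (sumTo-neg n f)) (sym (ℤP.neg-distrib-+ (sumTo n f) (f (suc n))))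

sumTo-zero : ∀ n (f : ℕ → ℤ) → (∀ i → f i ≡ + 0) → sumTo n f ≡ + 0
sumTo-zero zero    f f≗0 = f≗0 0
sumTo-zero (suc n) f f≗0 = cong₂ _+_ (sumTo-zero n f f≗0) (f≗0 (suc n))

sumTo-suc : ∀ n (f : ℕ → ℤ) → sumTo (suc n) f ≡ f 0 + sumTo n (f ∘ suc)
sumTo-suc zero    f = refl
sumTo-suc (suc n) f = trans (cong (_+ f (suc (suc n))) (sumTo-suc n f)) (ℤP.+-assoc (f 0) _ _)

0ˢ 1ˢ : PS
0ˢ _ = + 0
1ˢ = cst (+ 1)

-ˢ_ : PS → PS
(-ˢ f) n = - f n

_·ˢ_ : ℤ → PS → PS
(c ·ˢ f) n = c * f n

tail : PS → PS
tail f = f ∘ suc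

≈-refl : ∀ {f} → f ≈ f
≈-refl n = refl

≈-sym : ∀ {f g} → f ≈ g → g ≈ f
≈-sym f≈g n = sym (f≈g n)

≈-trans : ∀ {f g h} → f ≈ g → g ≈ h → f ≈ h
≈-trans f≈g g≈h n = trans (f≈g n) (g≈h n)

⊕-cong : ∀ {f f′ g g′} → f ≈ f′ → g ≈ g′ → f ⊕ g ≈ f′ ⊕ g′
⊕-cong f≈f′ g≈g′ n = cong₂ _+_ (f≈f′ n) (g≈g′ n)

⊖-cong : ∀ {f f′ g g′} → f ≈ f′ → g ≈ g′ → f ⊖ g ≈ f′ ⊖ g′
⊖-cong f≈f′ g≈g′ n = cong₂ _-_ (f≈f′ n) (g≈g′ n)

≈⇒⊖≈0 : ∀ {f g} → f ≈ g → f ⊖ g ≈ 0ˢ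
≈⇒⊖≈0 {g = g} f≈g n = trans (cong (_- g n) (f≈g n)) (ℤP.+-inverseʳ (g n))

⊛-congˡ : ∀ f {g h} → g ≈ h → f ⊛ g ≈ f ⊛ h
⊛-congˡ f g≈h n = sumTo-cong n (λ i _ → cong (f i *_) (g≈h (n ∸ i)))

⊛-congʳ : ∀ h {f g} → f ≈ g → f ⊛ h ≈ g ⊛ h
⊛-congʳ h f≈g n = sumTo-cong n (λ i _ → cong (_* h (n ∸ i)) (f≈g i))

⊛-cong : ∀ {f f′ g g′} → f ≈ f′ → g ≈ g′ → f ⊛ g ≈ f′ ⊛ g′
⊛-cong {f′ = f′} {g} f≈f′ g≈g′ = ≈-trans (⊛-congʳ g f≈f′) (⊛-congˡ f′ g≈g′)

⊛-suc : ∀ f g n → (f ⊛ g) (suc n) ≡ f 0 * g (suc n) + (tail f ⊛ g) n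
⊛-suc f g n = sumTo-suc n (λ i → f i * g (suc n ∸ i))

⊛-sucʳ : ∀ f g n → (f ⊛ g) (suc n) ≡ (f ⊛ tail g) n + f (suc n) * g 0
⊛-sucʳ f g n = cong₂ _+_
  (sumTo-cong n (λ i i≤n → cong (λ m → f i * g m) (ℕP.+-∸-assoc 1 i≤n)))
  (cong (λ m → f (suc n) * g m) (ℕP.n∸n≡0 n))

⊛-zeroˡ : ∀ f → 0ˢ ⊛ f ≈ 0ˢ
⊛-zeroˡ f n = sumTo-zero n _ (λ i → refl)

⊕-identityʳ′ : ∀ {f g} → g ≈ 0ˢ → f ⊕ g ≈ f
⊕-identityʳ′ {f} g≈0 n = trans (cong (_+_ (f n)) (g≈0 n)) (ℤP.+-identityʳ (f n))

⊛-comm : ∀ f g → f ⊛ g ≈ g ⊛ f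
⊛-comm f g zero    = ℤP.*-comm (f 0) (g 0)
⊛-comm f g (suc n) = begin
  (f ⊛ g) (suc n)                        ≡⟨ ⊛-suc f g n ⟩
  f 0 * g (suc n) + (tail f ⊛ g) n       ≡⟨ cong₂ _+_ (ℤP.*-comm (f 0) (g (suc n))) (⊛-comm (tail f) g n) ⟩
  g (suc n) * f 0 + (g ⊛ tail f) n       ≡⟨ ℤP.+-comm (g (suc n) * f 0) _ ⟩
  (g ⊛ tail f) n + g (suc n) * f 0       ≡⟨ ⊛-sucʳ g f n ⟨
  (g ⊛ f) (suc n)                        ∎
  where open ≡-Reasoning

⊛-distribʳ : ∀ h f g → (f ⊕ g) ⊛ h ≈ f ⊛ h ⊕ g ⊛ h
⊛-distribʳ h f g n =
  trans (sumTo-cong n (λ i _ → ℤP.*-distribʳ-+ (h (n ∸ i)) (f i) (g i))) (sumTo-+ n _ _)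

·ˢ-⊛ : ∀ c f g → (c ·ˢ f) ⊛ g ≈ c ·ˢ (f ⊛ g)
·ˢ-⊛ c f g n = trans (sumTo-cong n (λ i _ → ℤP.*-assoc c (f i) (g (n ∸ i)))) (sumTo-*ˡ n c _)

⊛-assoc : ∀ f g h → (f ⊛ g) ⊛ h ≈ f ⊛ (g ⊛ h)
⊛-assoc f g h zero    = ℤP.*-assoc (f 0) (g 0) (h 0)
⊛-assoc f g h (suc n) = begin
  ((f ⊛ g) ⊛ h) (suc n)
    ≡⟨ ⊛-suc (f ⊛ g) h n ⟩
  (f 0 * g 0) * h (suc n) + (tail (f ⊛ g) ⊛ h) n
    ≡⟨ cong₂ _+_ (ℤP.*-assoc (f 0) (g 0) (h (suc n)))
                 (trans (⊛-congʳ h (⊛-suc f g) n) (⊛-distribʳ h (f 0 ·ˢ tail g) (tail f ⊛ g) n)) ⟩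
  f 0 * (g 0 * h (suc n)) + (((f 0 ·ˢ tail g) ⊛ h) n + ((tail f ⊛ g) ⊛ h) n)
    ≡⟨ cong (_+_ (f 0 * (g 0 * h (suc n))))
            (cong₂ _+_ (·ˢ-⊛ (f 0) (tail g) h n) (⊛-assoc (tail f) g h n)) ⟩
  f 0 * (g 0 * h (suc n)) + (f 0 * (tail g ⊛ h) n + (tail f ⊛ (g ⊛ h)) n)
    ≡⟨ ℤP.+-assoc (f 0 * (g 0 * h (suc n))) _ _ ⟨
  (f 0 * (g 0 * h (suc n)) + f 0 * (tail g ⊛ h) n) + (tail f ⊛ (g ⊛ h)) n
    ≡⟨ cong (_+ (tail f ⊛ (g ⊛ h)) n) (ℤP.*-distribˡ-+ (f 0) _ _) ⟨
  f 0 * (g 0 * h (suc n) + (tail g ⊛ h) n) + (tail f ⊛ (g ⊛ h)) n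
    ≡⟨ cong (λ x → f 0 * x + (tail f ⊛ (g ⊛ h)) n) (⊛-suc g h n) ⟨
  f 0 * (g ⊛ h) (suc n) + (tail f ⊛ (g ⊛ h)) n
    ≡⟨ ⊛-suc f (g ⊛ h) n ⟨
  (f ⊛ (g ⊛ h)) (suc n) ∎
  where open ≡-Reasoning

⊛-identityˡ : ∀ f → 1ˢ ⊛ f ≈ f
⊛-identityˡ f zero    = ℤP.*-identityˡ (f 0)
⊛-identityˡ f (suc n) = begin
  (1ˢ ⊛ f) (suc n)                  ≡⟨ ⊛-suc 1ˢ f n ⟩
  + 1 * f (suc n) + (0ˢ ⊛ f) n       ≡⟨ cong₂ _+_ (ℤP.*-identityˡ (f (suc n))) (⊛-zeroˡ f n) ⟩
  f (suc n) + + 0                    ≡⟨ ℤP.+-identityʳ (f (suc n)) ⟩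
  f (suc n)                          ∎
  where open ≡-Reasoning

⊛-identityʳ : ∀ f → f ⊛ 1ˢ ≈ f
⊛-identityʳ f = ≈-trans (⊛-comm f 1ˢ) (⊛-identityˡ f)

⊛-≈0ʳ : ∀ f {g} → g ≈ 0ˢ → f ⊛ g ≈ 0ˢ
⊛-≈0ʳ f {g} g≈0 = ≈-trans (⊛-congˡ f g≈0) (≈-trans (⊛-comm f 0ˢ) (⊛-zeroˡ f))

cst0≈0ˢ : cst (+ 0) ≈ 0ˢ
cst0≈0ˢ zero    = refl
cst0≈0ˢ (suc n) = refl

cst-⊛ : ∀ c f → cst c ⊛ f ≈ c ·ˢ f
cst-⊛ c f zero    = refl
cst-⊛ c f (suc n) = begin
  (cst c ⊛ f) (suc n)         ≡⟨ ⊛-suc (cst c) f n ⟩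
  c * f (suc n) + (0ˢ ⊛ f) n  ≡⟨ cong (_+_ (c * f (suc n))) (⊛-zeroˡ f n) ⟩
  c * f (suc n) + + 0         ≡⟨ ℤP.+-identityʳ _ ⟩
  c * f (suc n)               ∎
  where open ≡-Reasoning

PS-ring : AlmostCommutativeRing 0ℓ 0ℓ
PS-ring = record
  { Carrier = PS ; _≈_ = _≈_ ; _+_ = _⊕_ ; _*_ = _⊛_ ; -_ = -ˢ_ ; 0# = 0ˢ ; 1# = 1ˢ
  ; isAlmostCommutativeRing = record
    { isCommutativeSemiring = IsCommutativeSemiringˡ.isCommutativeSemiring (record
      { +-isCommutativeMonoid = record
        { isMonoid = record
          { isSemigroup = record
            { isMagma = record { isEquivalence = ≈-isEquivalence ; ∙-cong = ⊕-cong }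
            ; assoc = λ f g h n → ℤP.+-assoc (f n) (g n) (h n) }
          ; identity = (λ f n → ℤP.+-identityˡ (f n)) , (λ f n → ℤP.+-identityʳ (f n)) }
        ; comm = λ f g n → ℤP.+-comm (f n) (g n) }
      ; *-isCommutativeMonoid = record
        { isMonoid = record
          { isSemigroup = record
            { isMagma = record { isEquivalence = ≈-isEquivalence ; ∙-cong = ⊛-cong }
            ; assoc = ⊛-assoc }
          ; identity = ⊛-identityˡ , ⊛-identityʳ }
        ; comm = ⊛-comm }
      ; distribʳ = ⊛-distribʳ
      ; zeroˡ = ⊛-zeroˡ })
    ; -‿cong = λ f≈g n → cong -_ (f≈g n)
    ; -‿*-distribˡ = λ f g n →
        trans (sumTo-cong n (λ i _ → sym (ℤP.neg-distribˡ-* (f i) (g (n ∸ i))))) (sumTo-neg n _)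
    ; -‿+-comm = λ f g n → sym (ℤP.neg-distrib-+ (f n) (g n)) } }
  where
  ≈-isEquivalence : IsEquivalence _≈_
  ≈-isEquivalence = record { refl = ≈-refl ; sym = ≈-sym ; trans = ≈-trans }

cst-homomorphism : ℤ.+-*-rawRing -Raw-AlmostCommutative⟶ PS-ring
cst-homomorphism = record
  { ⟦_⟧    = cst
  ; +-homo = λ a b → λ { zero → refl ; (suc n) → refl }
  ; *-homo = λ a b → ≈-sym (≈-trans (cst-⊛ a (cst b)) λ { zero → refl ; (suc n) → ℤP.*-zeroʳ a })
  ; -‿homo = λ a → λ { zero → refl ; (suc n) → refl }
  ; 0-homo = λ { zero → refl ; (suc n) → refl }
  ; 1-homo = ≈-refl }

cst-≟ : ∀ a b → Maybe (cst a ≈ cst b)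
cst-≟ a b with a ℤ.≟ b
... | yes refl = just ≈-refl
... | no _     = nothing

open import Algebra.Solver.Ring ℤ.+-*-rawRing PS-ring cst-homomorphism cst-≟
  using (Polynomial; solve; _:=_; _:+_; _:*_; _:-_; :-_; _:^_; con)

module ≈-Reasoning = Relation.Binary.Reasoning.Setoid (AlmostCommutativeRing.setoid PS-ring)

X : PS
X = z^ 1

X⊛-suc : ∀ f n → (X ⊛ f) (suc n) ≡ f n
X⊛-suc f n = trans (⊛-suc X f n) (trans (ℤP.+-identityˡ _) (⊛-identityˡ f n))

X^suc⊛-suc : ∀ d f n → (X ^ˢ suc d ⊛ f) (suc n) ≡ (X ^ˢ d ⊛ f) n
X^suc⊛-suc d f n = trans (⊛-assoc X (X ^ˢ d) f (suc n)) (X⊛-suc (X ^ˢ d ⊛ f) n)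

X^-⊛-+ : ∀ d f n → (X ^ˢ d ⊛ f) (d ℕ.+ n) ≡ f n
X^-⊛-+ zero    f n = ⊛-identityˡ f n
X^-⊛-+ (suc d) f n = trans (X^suc⊛-suc d f (d ℕ.+ n)) (X^-⊛-+ d f n)

⊛-causal : ∀ f {g h} n → (∀ m → m ℕ.≤ n → g m ≡ h m) → (f ⊛ g) n ≡ (f ⊛ h) n
⊛-causal f n g≗h = sumTo-cong n (λ i _ → cong (f i *_) (g≗h (n ∸ i) (ℕP.m∸n≤m n i)))

X⊛-strictlyCausal : ∀ {g h} n → (∀ m → m ℕ.< n → g m ≡ h m) → (X ⊛ g) n ≡ (X ⊛ h) n
X⊛-strictlyCausal {g} {h} zero    _   = refl
X⊛-strictlyCausal {g} {h} (suc n) g≗h =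
  trans (X⊛-suc g n) (trans (g≗h n ℕP.≤-refl) (sym (X⊛-suc h n)))

-- The quadratic equation for r

horner : List ℤ → PS
horner []       = cst (+ 0)
horner (c ∷ cs) = cst c ⊕ X ⊛ horner cs

poly≈horner : ∀ cs → poly cs ≈ horner cs
poly≈horner []       zero    = refl
poly≈horner []       (suc n) = refl
poly≈horner (c ∷ cs) zero    = sym (ℤP.+-identityʳ c)
poly≈horner (c ∷ cs) (suc n) =
  trans (poly≈horner cs n) (sym (trans (ℤP.+-identityˡ _) (X⊛-suc (horner cs) n)))

mono≈cst⊛X^ : ∀ c d → mono c d ≈ cst c ⊛ X ^ˢ d
mono≈cst⊛X^ c zero    = ≈-sym (⊛-identityʳ (cst c))
mono≈cst⊛X^ c (suc d) = begin
  mono c (suc d)        ≈⟨ mono-suc ⟩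
  X ⊛ mono c d          ≈⟨ ⊛-congˡ X (mono≈cst⊛X^ c d) ⟩
  X ⊛ (cst c ⊛ X ^ˢ d)  ≈⟨ solve 3 (λ x a p → x :* (a :* p) := a :* (x :* p)) ≈-refl X (cst c) (X ^ˢ d) ⟩
  cst c ⊛ X ^ˢ suc d    ∎
  where
  open ≈-Reasoning
  mono-suc : mono c (suc d) ≈ X ⊛ mono c d
  mono-suc zero    = refl
  mono-suc (suc n) = sym (X⊛-suc (mono c d) n)

z^≈X^ : ∀ d → z^ d ≈ X ^ˢ d
z^≈X^ d = ≈-trans (mono≈cst⊛X^ (+ 1) d) (⊛-identityˡ (X ^ˢ d))

cst⊛X^-cancel : ∀ c d {f} .{{_ : ℤ.NonZero c}} → cst c ⊛ (X ^ˢ d ⊛ f) ≈ 0ˢ → f ≈ 0ˢ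
cst⊛X^-cancel c d {f} c·Xᵈf≈0 n = ℤP.*-cancelˡ-≡ c (f n) (+ 0) (begin
  c * f n                                ≡⟨ cong (c *_) (X^-⊛-+ d f n) ⟨
  c * (X ^ˢ d ⊛ f) (d ℕ.+ n)             ≡⟨ cst-⊛ c (X ^ˢ d ⊛ f) (d ℕ.+ n) ⟨
  (cst c ⊛ (X ^ˢ d ⊛ f)) (d ℕ.+ n)       ≡⟨ c·Xᵈf≈0 (d ℕ.+ n) ⟩
  + 0                                    ≡⟨ ℤP.*-zeroʳ c ⟨
  c * + 0                                ∎)
  where open ≡-Reasoning

hornerᵖ : ∀ {m} → List ℤ → Polynomial m → Polynomial m
hornerᵖ []       x = con (+ 0)
hornerᵖ (c ∷ cs) x = con c :+ x :* hornerᵖ cs x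

A : PS
A = 1ˢ ⊖ X ^ˢ 2 ⊖ X ^ˢ 4

Aᵖ : ∀ {m} → Polynomial m → Polynomial m
Aᵖ x = con (+ 1) :- x :^ 2 :- x :^ 4

Quadratic : PS → PS
Quadratic r = X ^ˢ 3 ⊛ (r ⊛ r) ⊖ A ⊛ r ⊕ X ^ˢ 3

Quadraticᵖ : ∀ {m} → Polynomial m → Polynomial m → Polynomial m
Quadraticᵖ x r = x :^ 3 :* (r :* r) :- Aᵖ x :* r :+ x :^ 3

Apoly≈A : Apoly ≈ A
Apoly≈A = ≈-trans (poly≈horner coeffs) (solve 1 (λ x → hornerᵖ coeffs x := Aᵖ x) ≈-refl X)
  where
  coeffs : List ℤ
  coeffs = + 1 ∷ + 0 ∷ - (+ 1) ∷ + 0 ∷ - (+ 1) ∷ []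

Dpoly≈A²-4X⁶ : Dpoly ≈ A ⊛ A ⊖ cst (+ 4) ⊛ X ^ˢ 6
Dpoly≈A²-4X⁶ = ≈-trans (poly≈horner coeffs)
  (solve 1 (λ x → hornerᵖ coeffs x := Aᵖ x :* Aᵖ x :- con (+ 4) :* x :^ 6) ≈-refl X)
  where
  coeffs : List ℤ
  coeffs = + 1 ∷ + 0 ∷ - (+ 2) ∷ + 0 ∷ - (+ 1) ∷ + 0 ∷ - (+ 2) ∷ + 0 ∷ + 1 ∷ []

square-completion : ∀ r → (A ⊖ cst (+ 2) ⊛ X ^ˢ 3 ⊛ r) ⊛ (A ⊖ cst (+ 2) ⊛ X ^ˢ 3 ⊛ r)
                          ≈ (A ⊛ A ⊖ cst (+ 4) ⊛ X ^ˢ 6) ⊕ cst (+ 4) ⊛ (X ^ˢ 3 ⊛ Quadratic r)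
square-completion = solve 2 (λ x r →
  (Aᵖ x :- con (+ 2) :* x :^ 3 :* r) :* (Aᵖ x :- con (+ 2) :* x :^ 3 :* r)
    := (Aᵖ x :* Aᵖ x :- con (+ 4) :* x :^ 6) :+ con (+ 4) :* (x :^ 3 :* Quadraticᵖ x r)) ≈-refl X

s≈A-2X³r : ∀ {s r} → mono (+ 2) 3 ⊛ r ≈ Apoly ⊖ s → s ≈ A ⊖ cst (+ 2) ⊛ X ^ˢ 3 ⊛ r
s≈A-2X³r {s} {r} 2z³r≈A-s = begin
  s                           ≈⟨ solve 2 (λ a s → s := a :- (a :- s)) ≈-refl Apoly s ⟩
  Apoly ⊖ (Apoly ⊖ s)         ≈⟨ ⊖-cong Apoly≈A (≈-sym 2z³r≈A-s) ⟩
  A ⊖ mono (+ 2) 3 ⊛ r        ≈⟨ ⊖-cong (≈-refl {A}) (⊛-congʳ r (mono≈cst⊛X^ (+ 2) 3)) ⟩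
  A ⊖ cst (+ 2) ⊛ X ^ˢ 3 ⊛ r  ∎
  where open ≈-Reasoning

IsR⇒root : ∀ {s r} → IsR s r → Quadratic r ≈ 0ˢ
IsR⇒root {s} {r} ((_ , s²≈D) , 2z³r≈A-s) = cst⊛X^-cancel (+ 4) 3 λ n →
  +-cancelˡ (D n) _ (+ 0) (trans (square≈D n) (sym (ℤP.+-identityʳ (D n))))
  where
  D : PS
  D = A ⊛ A ⊖ cst (+ 4) ⊛ X ^ˢ 6
  s-formula : s ≈ A ⊖ cst (+ 2) ⊛ X ^ˢ 3 ⊛ r
  s-formula = s≈A-2X³r {s} {r} 2z³r≈A-s
  square≈D : D ⊕ cst (+ 4) ⊛ (X ^ˢ 3 ⊛ Quadratic r) ≈ D
  square≈D = begin
    D ⊕ cst (+ 4) ⊛ (X ^ˢ 3 ⊛ Quadratic r)                        ≈⟨ square-completion r ⟨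
    (A ⊖ cst (+ 2) ⊛ X ^ˢ 3 ⊛ r) ⊛ (A ⊖ cst (+ 2) ⊛ X ^ˢ 3 ⊛ r)  ≈⟨ ⊛-cong s-formula s-formula ⟨
    s ⊛ s                                                          ≈⟨ s²≈D ⟩
    Dpoly                                                          ≈⟨ Dpoly≈A²-4X⁶ ⟩
    D                                                              ∎
    where open ≈-Reasoning

root⇒IsR : ∀ {r} → Quadratic r ≈ 0ˢ → IsR (Apoly ⊖ mono (+ 2) 3 ⊛ r) r
root⇒IsR {r} Q≈0 = (refl , square≈D) , 2z³r≈A-s
  where
  s : PS
  s = Apoly ⊖ mono (+ 2) 3 ⊛ r
  2z³r≈A-s : mono (+ 2) 3 ⊛ r ≈ Apoly ⊖ s
  2z³r≈A-s = solve 2 (λ a m → m := a :- (a :- m)) ≈-refl Apoly (mono (+ 2) 3 ⊛ r)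
  s-formula : s ≈ A ⊖ cst (+ 2) ⊛ X ^ˢ 3 ⊛ r
  s-formula = s≈A-2X³r {s} {r} 2z³r≈A-s
  square≈D : s ⊛ s ≈ Dpoly
  square≈D = begin
    s ⊛ s
      ≈⟨ ⊛-cong s-formula s-formula ⟩
    (A ⊖ cst (+ 2) ⊛ X ^ˢ 3 ⊛ r) ⊛ (A ⊖ cst (+ 2) ⊛ X ^ˢ 3 ⊛ r)
      ≈⟨ square-completion r ⟩
    (A ⊛ A ⊖ cst (+ 4) ⊛ X ^ˢ 6) ⊕ cst (+ 4) ⊛ (X ^ˢ 3 ⊛ Quadratic r)
      ≈⟨ ⊕-identityʳ′ (⊛-≈0ʳ (cst (+ 4)) (⊛-≈0ʳ (X ^ˢ 3) Q≈0)) ⟩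
    A ⊛ A ⊖ cst (+ 4) ⊛ X ^ˢ 6
      ≈⟨ Dpoly≈A²-4X⁶ ⟨
    Dpoly
      ∎
    where open ≈-Reasoning

-- The kernel equation

Agree : ℕ → (ℕ → PS) → (ℕ → PS) → Set
Agree n x y = ∀ k m → m ℕ.< n → x k m ≡ y k m

Causal : ((ℕ → PS) → ℕ → PS) → Set
Causal Φ = ∀ {x y} n → Agree (suc n) x y → ∀ k → Φ x k n ≡ Φ y k n

fixpoint-unique : ∀ {Φ} {x y : ℕ → PS} → Causal Φ →
                  (∀ k → x k ≈ X ⊛ Φ x k) → (∀ k → y k ≈ X ⊛ Φ y k) → ∀ k → x k ≈ y k
fixpoint-unique {Φ} {x} {y} Φ-causal x-eq y-eq k n = agree (suc n) k n ℕP.≤-refl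
  where
  agree : ∀ n → Agree n x y
  agree zero    k m ()
  agree (suc n) k m m<1+n with ℕP.m≤n⇒m<n∨m≡n (ℕP.≤-pred m<1+n)
  ... | inj₁ m<n  = agree n k m m<n
  ... | inj₂ refl = begin
    x k m          ≡⟨ x-eq k m ⟩
    (X ⊛ Φ x k) m  ≡⟨ X⊛-strictlyCausal m Φx≗Φy ⟩
    (X ⊛ Φ y k) m  ≡⟨ y-eq k m ⟨
    y k m          ∎
    where
    open ≡-Reasoning
    Φx≗Φy : ∀ i → i ℕ.< m → Φ x k i ≡ Φ y k i
    Φx≗Φy i i<m = Φ-causal i (λ k′ j j≤i → agree m k′ j (ℕP.≤-trans j≤i i<m)) k

below : PS → (ℕ → PS) → ℕ → PS
below b x zero    = b
below b x (suc k) = x k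

kernel : PS → (ℕ → PS) → ℕ → PS
kernel b x k = (X ⊕ X ^ˢ 3) ⊛ x k ⊕ X ^ˢ 2 ⊛ (x (suc k) ⊕ below b x k)

-- (1 − z² − z⁴) x_k = z³ (x_{k+1} + x_{k−1}) with x_{−1} = b, written as x_k = z · (…)
KernelEq : PS → (ℕ → PS) → Set
KernelEq b x = ∀ k → x k ≈ X ⊛ kernel b x k

kernel-causal : ∀ b → Causal (kernel b)
kernel-causal b {x} {y} n x≐y k = cong₂ _+_
  (⊛-causal (X ⊕ X ^ˢ 3) n (λ m m≤n → x≐y k m (s≤s m≤n)))
  (⊛-causal (X ^ˢ 2) n (λ m m≤n → cong₂ _+_ (x≐y (suc k) m (s≤s m≤n)) (below-agree k m (s≤s m≤n))))
  where
  below-agree : ∀ k m → m ℕ.< suc n → below b x k m ≡ below b y k m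
  below-agree zero    m _   = refl
  below-agree (suc k) m m<n = x≐y k m m<n

KernelEq-unique : ∀ {b x y} → KernelEq b x → KernelEq b y → ∀ k → x k ≈ y k
KernelEq-unique {b} = fixpoint-unique (kernel-causal b)

kernel-below : ∀ {b x} k {c} → below b x k ≈ c →
               kernel b x k ≈ (X ⊕ X ^ˢ 3) ⊛ x k ⊕ X ^ˢ 2 ⊛ (x (suc k) ⊕ c)
kernel-below {x = x} k below≈c =
  ⊕-cong (≈-refl {(X ⊕ X ^ˢ 3) ⊛ x k}) (⊛-congˡ (X ^ˢ 2) (⊕-cong (≈-refl {x (suc k)}) below≈c))

KernelEq-tail : ∀ {b x} → KernelEq b x → KernelEq (x 0) (x ∘ suc)
KernelEq-tail {b} {x} eq k =
  ≈-trans (eq (suc k)) (⊛-congˡ X (≈-sym (kernel-below {x 0} {x ∘ suc} k (below-tail k))))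
  where
  below-tail : ∀ k → below (x 0) (x ∘ suc) k ≈ x k
  below-tail zero    = ≈-refl
  below-tail (suc k) = ≈-refl

KernelEq-⊛ : ∀ {x} c → KernelEq 1ˢ x → KernelEq c (λ k → c ⊛ x k)
KernelEq-⊛ {x} c eq k = begin
  c ⊛ x k
    ≈⟨ ⊛-congˡ c (eq k) ⟩
  c ⊛ (X ⊛ kernel 1ˢ x k)
    ≈⟨ solve 5 (λ x c a a′ b → c :* (x :* ((x :+ x :^ 3) :* a :+ x :^ 2 :* (a′ :+ b)))
                  := x :* ((x :+ x :^ 3) :* (c :* a) :+ x :^ 2 :* (c :* a′ :+ c :* b)))
                ≈-refl X c (x k) (x (suc k)) (below 1ˢ x k) ⟩
  X ⊛ ((X ⊕ X ^ˢ 3) ⊛ (c ⊛ x k) ⊕ X ^ˢ 2 ⊛ (c ⊛ x (suc k) ⊕ c ⊛ below 1ˢ x k))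
    ≈⟨ ⊛-congˡ X (kernel-below k (below-⊛ k)) ⟨
  X ⊛ kernel c (λ k → c ⊛ x k) k
    ∎
  where
  open ≈-Reasoning
  below-⊛ : ∀ k → below c (λ k → c ⊛ x k) k ≈ c ⊛ below 1ˢ x k
  below-⊛ zero    = ≈-sym (⊛-identityʳ c)
  below-⊛ (suc k) = ≈-refl

KernelEq-root : ∀ {x} → KernelEq 1ˢ x → Quadratic (x 0) ≈ 0ˢ
KernelEq-root {x} eq = begin
  Quadratic (x 0)
    ≈⟨ solve 4 (λ x a a′ s → x :^ 3 :* s :- Aᵖ x :* a :+ x :^ 3
                  := (x :* ((x :+ x :^ 3) :* a :+ x :^ 2 :* (a′ :+ con (+ 1))) :- a) :+ x :^ 3 :* (s :- a′))
                ≈-refl X (x 0) (x 1) (x 0 ⊛ x 0) ⟩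
  (X ⊛ kernel 1ˢ x 0 ⊖ x 0) ⊕ X ^ˢ 3 ⊛ (x 0 ⊛ x 0 ⊖ x 1)
    ≈⟨ ⊕-cong (≈⇒⊖≈0 (≈-sym (eq 0))) (⊛-≈0ʳ (X ^ˢ 3) (≈⇒⊖≈0 (≈-sym x₁≈x₀²))) ⟩
  0ˢ ⊕ 0ˢ
    ≈⟨ ⊕-identityʳ′ ≈-refl ⟩
  0ˢ
    ∎
  where
  open ≈-Reasoning
  x₁≈x₀² : x 1 ≈ x 0 ⊛ x 0
  x₁≈x₀² = KernelEq-unique (KernelEq-tail eq) (KernelEq-⊛ (x 0) eq) 0

powers-KernelEq : ∀ {r} → Quadratic r ≈ 0ˢ → KernelEq 1ˢ (λ k → r ^ˢ suc k)
powers-KernelEq {r} Q≈0 k = begin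
  r ⊛ r ^ˢ k
    ≈⟨ ⊕-identityʳ′ (⊛-≈0ʳ (r ^ˢ k) Q≈0) ⟨
  r ⊛ r ^ˢ k ⊕ r ^ˢ k ⊛ Quadratic r
    ≈⟨ solve 3 (λ x r p → r :* p :+ p :* Quadraticᵖ x r
                  := x :* ((x :+ x :^ 3) :* (r :* p) :+ x :^ 2 :* (r :* (r :* p) :+ p)))
                ≈-refl X r (r ^ˢ k) ⟩
  X ⊛ ((X ⊕ X ^ˢ 3) ⊛ r ^ˢ suc k ⊕ X ^ˢ 2 ⊛ (r ^ˢ suc (suc k) ⊕ r ^ˢ k))
    ≈⟨ ⊛-congˡ X (kernel-below k (below-powers k)) ⟨
  X ⊛ kernel 1ˢ (λ k → r ^ˢ suc k) k
    ∎
  where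
  open ≈-Reasoning
  below-powers : ∀ k → below 1ˢ (λ k → r ^ˢ suc k) k ≈ r ^ˢ k
  below-powers zero    = ≈-refl
  below-powers (suc k) = ≈-refl

-- Partial zigzag knight's paths

CanFollow : Maybe Bool → Step → Set
CanFollow nothing  s = ⊤
CanFollow (just b) s = b ≡ not (up s)

ZigzagAfter : Maybe Bool → List Step → Set
ZigzagAfter m []      = ⊤
ZigzagAfter m (s ∷ p) = CanFollow m s × ZigzagAfter (just (up s)) p

lastDir : Maybe Bool → List Step → Maybe Bool
lastDir m []      = m
lastDir m (s ∷ p) = lastDir (just (up s)) p

Alternating⇒ZigzagAfter : ∀ p → Alternating p → ZigzagAfter nothing p
Alternating⇒ZigzagAfter []      _   = tt
Alternating⇒ZigzagAfter (s ∷ p) alt = tt , go s p alt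
  where
  go : ∀ s p → Alternating (s ∷ p) → ZigzagAfter (just (up s)) p
  go s []      _         = tt
  go s (t ∷ p) (s≁t , a) = s≁t , go t p a

ZigzagAfter⇒Alternating : ∀ p → ZigzagAfter nothing p → Alternating p
ZigzagAfter⇒Alternating []      _        = tt
ZigzagAfter⇒Alternating (s ∷ p) (_ , zz) = go s p zz
  where
  go : ∀ s p → ZigzagAfter (just (up s)) p → Alternating (s ∷ p)
  go s []      _          = tt
  go s (t ∷ p) (s≁t , zz) = s≁t , go t p zz

ZigzagAfter-++⁻ˡ : ∀ m p q → ZigzagAfter m (p ++ q) → ZigzagAfter m p
ZigzagAfter-++⁻ˡ m []      q _        = tt
ZigzagAfter-++⁻ˡ m (s ∷ p) q (c , zz) = c , ZigzagAfter-++⁻ˡ _ p q zz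

ZigzagAfter-++⁻ʳ : ∀ m p q → ZigzagAfter m (p ++ q) → ZigzagAfter (lastDir m p) q
ZigzagAfter-++⁻ʳ m []      q zz       = zz
ZigzagAfter-++⁻ʳ m (s ∷ p) q (_ , zz) = ZigzagAfter-++⁻ʳ _ p q zz

ZigzagAfter-++⁺ : ∀ m p q → ZigzagAfter m p → ZigzagAfter (lastDir m p) q → ZigzagAfter m (p ++ q)
ZigzagAfter-++⁺ m []      q _        zz′ = zz′
ZigzagAfter-++⁺ m (s ∷ p) q (c , zz) zz′ = c , ZigzagAfter-++⁺ _ p q zz zz′

lastDir-∷ʳ : ∀ m q s → lastDir m (q ∷ʳ s) ≡ just (up s)
lastDir-∷ʳ m []      s = refl
lastDir-∷ʳ m (t ∷ q) s = lastDir-∷ʳ _ q s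

endHeight-++ : ∀ h p q → endHeight h (p ++ q) ≡ endHeight (endHeight h p) q
endHeight-++ h []      q = refl
endHeight-++ h (s ∷ p) q = endHeight-++ _ p q

endHeight-∷ʳ : ∀ h q s → endHeight h (q ∷ʳ s) ≡ dy s + endHeight h q
endHeight-∷ʳ h q s = trans (endHeight-++ h q (s ∷ [])) (ℤP.+-comm (endHeight h q) (dy s))

Valid-++⁻ˡ : ∀ h p q → Valid h (p ++ q) → Valid h p
Valid-++⁻ˡ h []      q _       = tt
Valid-++⁻ˡ h (s ∷ p) q (v , w) = v , Valid-++⁻ˡ _ p q w

Valid-++⁺ : ∀ h p q → Valid h p → Valid (endHeight h p) q → Valid h (p ++ q)
Valid-++⁺ h []      q _       w′ = w′
Valid-++⁺ h (s ∷ p) q (v , w) w′ = v , Valid-++⁺ _ p q w w′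

Valid⇒endHeight≥0 : ∀ h p → + 0 ℤ.≤ h → Valid h p → + 0 ℤ.≤ endHeight h p
Valid⇒endHeight≥0 h []      0≤h _       = 0≤h
Valid⇒endHeight≥0 h (s ∷ p) _   (v , w) = Valid⇒endHeight≥0 _ p v w

Valid⇒endHeight-ℕ : ∀ p → Valid (+ 0) p → Σ ℕ λ j → endHeight (+ 0) p ≡ + j
Valid⇒endHeight-ℕ p v with endHeight (+ 0) p | Valid⇒endHeight≥0 (+ 0) p (ℤ.+≤+ z≤n) v
... | + j | _ = j , refl

size-∷ʳ : ∀ q s → size (q ∷ʳ s) ≡ dx s ℕ.+ size q
size-∷ʳ q s = begin
  sum (map dx (q ++ s ∷ []))         ≡⟨ cong sum (LP.map-++ dx q (s ∷ [])) ⟩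
  sum (map dx q ++ dx s ∷ [])        ≡⟨ sum-++ (map dx q) (dx s ∷ []) ⟩
  size q ℕ.+ (dx s ℕ.+ 0)            ≡⟨ ℕP.+-comm (size q) (dx s ℕ.+ 0) ⟩
  (dx s ℕ.+ 0) ℕ.+ size q            ≡⟨ cong (ℕ._+ size q) (ℕP.+-identityʳ (dx s)) ⟩
  dx s ℕ.+ size q                    ∎
  where open ≡-Reasoning

descent : ℕ → Maybe Bool → List Step
descent zero    m            = []
descent (suc h) (just false) = E ∷ N̄ ∷ descent h (just false)
descent (suc h) (just true)  = Ē ∷ descent h (just false)
descent (suc h) nothing      = Ē ∷ descent h (just false)

E-N̄-height : ∀ h → + suc h + dy E + dy N̄ ≡ + h
E-N̄-height h rewrite ℕP.+-comm h 1 = refl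

descent-returns : ∀ h m → Valid (+ h) (descent h m) × endHeight (+ h) (descent h m) ≡ + 0
                          × ZigzagAfter m (descent h m)
descent-returns zero    m            = tt , refl , tt
descent-returns (suc h) (just false) with descent-returns h (just false)
... | v , e , zz rewrite E-N̄-height h = (ℤ.+≤+ z≤n , ℤ.+≤+ z≤n , v) , e , refl , refl , zz
descent-returns (suc h) (just true)  =
  let v , e , zz = descent-returns h (just false) in (ℤ.+≤+ z≤n , v) , e , refl , zz
descent-returns (suc h) nothing      =
  let v , e , zz = descent-returns h (just false) in (ℤ.+≤+ z≤n , v) , e , tt , zz

Admissible : List Step → Set
Admissible p = Valid (+ 0) p × ZigzagAfter nothing p

PartialZigzag⇒Admissible : ∀ p → PartialZigzag p → Admissible p
PartialZigzag⇒Admissible p (q , (v , _) , alt) =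
  Valid-++⁻ˡ (+ 0) p q v , ZigzagAfter-++⁻ˡ nothing p q (Alternating⇒ZigzagAfter (p ++ q) alt)

Admissible⇒PartialZigzag : ∀ p → Admissible p → PartialZigzag p
Admissible⇒PartialZigzag p (v , zz) with Valid⇒endHeight-ℕ p v
... | j , ht with descent-returns j (lastDir nothing p)
... | v′ , ht′ , zz′ =
  tail′ , (Valid-++⁺ (+ 0) p tail′ v (subst (λ h → Valid h tail′) (sym ht) v′) , height) ,
  ZigzagAfter⇒Alternating (p ++ tail′) (ZigzagAfter-++⁺ nothing p tail′ zz zz′)
  where
  tail′ : List Step
  tail′ = descent j (lastDir nothing p)
  height : endHeight (+ 0) (p ++ tail′) ≡ + 0
  height = trans (endHeight-++ (+ 0) p tail′) (trans (cong (λ h → endHeight h tail′) ht) ht′)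

LastDir : Bool → List Step → Set
LastDir b p = ∃₂ λ q s → (p ≡ q ∷ʳ s) × (up s ≡ b)

CanFollow-∷ʳ : ∀ q s → LastDir (not (up s)) q ⊎ q ≡ [] → CanFollow (lastDir nothing q) s
CanFollow-∷ʳ .(q ∷ʳ t) s (inj₁ (q , t , refl , t≁s)) rewrite lastDir-∷ʳ nothing q t = t≁s
CanFollow-∷ʳ .[]       s (inj₂ refl)                 = tt

CanFollow-∷ʳ⁻ : ∀ q s → CanFollow (lastDir nothing q) s → LastDir (not (up s)) q ⊎ q ≡ []
CanFollow-∷ʳ⁻ q s c with initLast q
... | []       = inj₂ refl
... | q′ ∷ʳ′ t rewrite lastDir-∷ʳ nothing q′ t = inj₁ (q′ , t , refl , c)

Reaches : ℕ → ℕ → List Step → Set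
Reaches k n p = Admissible p × size p ≡ n × endHeight (+ 0) p ≡ + k

Reaches-∷ʳ⁺ : ∀ {k k′ n q} s → Reaches k n q → LastDir (not (up s)) q ⊎ q ≡ [] →
              dy s + + k ≡ + k′ → Reaches k′ (dx s ℕ.+ n) (q ∷ʳ s)
Reaches-∷ʳ⁺ {k′ = k′} {q = q} s ((v , zz) , refl , ht) last ht′ =
  (Valid-++⁺ (+ 0) q (s ∷ []) v (subst (+ 0 ℤ.≤_) (sym height′) (ℤ.+≤+ z≤n) , tt) ,
   ZigzagAfter-++⁺ nothing q (s ∷ []) zz (CanFollow-∷ʳ q s last , tt)) ,
  size-∷ʳ q s , trans (endHeight-∷ʳ (+ 0) q s) height
  where
  height : dy s + endHeight (+ 0) q ≡ + k′
  height = trans (cong (_+_ (dy s)) ht) ht′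
  height′ : endHeight (+ 0) q + dy s ≡ + k′
  height′ = trans (ℤP.+-comm (endHeight (+ 0) q) (dy s)) height

Reaches-∷ʳ⁻ : ∀ {k n q} s → Reaches k (dx s ℕ.+ n) (q ∷ʳ s) →
              Σ ℕ λ j → Reaches j n q × (LastDir (not (up s)) q ⊎ q ≡ []) × dy s + + j ≡ + k
Reaches-∷ʳ⁻ {k} {n} {q} s ((v , zz) , sz , ht) with Valid⇒endHeight-ℕ q (Valid-++⁻ˡ (+ 0) q (s ∷ []) v)
... | j , htq =
  j ,
  ((Valid-++⁻ˡ (+ 0) q (s ∷ []) v , ZigzagAfter-++⁻ˡ nothing q (s ∷ []) zz) ,
   ℕP.+-cancelˡ-≡ (dx s) (size q) n (trans (sym (size-∷ʳ q s)) sz) , htq) ,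
  CanFollow-∷ʳ⁻ q s (proj₁ (ZigzagAfter-++⁻ʳ nothing q (s ∷ []) zz)) ,
  trans (cong (_+_ (dy s)) (sym htq)) (trans (sym (endHeight-∷ʳ (+ 0) q s)) ht)

dx≤size-∷ʳ : ∀ q s → dx s ℕ.≤ size (q ∷ʳ s)
dx≤size-∷ʳ q s = subst (dx s ℕ.≤_) (sym (size-∷ʳ q s)) (ℕP.m≤m+n (dx s) (size q))

-[1+d]+j≡k⇒j≡1+d+k : ∀ d j k → -[1+ d ] + + j ≡ + k → j ≡ suc d ℕ.+ k
-[1+d]+j≡k⇒j≡1+d+k d j k eq = ℤP.+-injective (begin
  + j                          ≡⟨ ℤP.+-identityˡ (+ j) ⟨
  + 0 + + j                    ≡⟨ cong (_+ + j) (ℤP.+-inverseʳ (+ suc d)) ⟨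
  (+ suc d + -[1+ d ]) + + j   ≡⟨ ℤP.+-assoc (+ suc d) -[1+ d ] (+ j) ⟩
  + suc d + (-[1+ d ] + + j)   ≡⟨ cong (_+_ (+ suc d)) eq ⟩
  + suc d + + k                ∎)
  where open ≡-Reasoning

-- Enumeration by height, size and last step

EndingUp EndingDown : ℕ → ℕ → List Step → Set
EndingUp   k n p = Reaches k n p × LastUp p
EndingDown k n p = Reaches k n p × (LastDown p ⊎ p ≡ [])

emptyPath : ℕ → List (List Step)
emptyPath zero    = [] ∷ []
emptyPath (suc k) = []

emptyPath-unique : ∀ k → Unique (emptyPath k)
emptyPath-unique zero    = [] ∷ []
emptyPath-unique (suc k) = []

mutual
  endingUp : ℕ → ℕ → List (List Step)
  endingUp k zero    = []
  endingUp k (suc n) = upByN k n ++ upByE k n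

  upByN : ℕ → ℕ → List (List Step)
  upByN (suc (suc k)) n = map (_∷ʳ N) (endingDown k n)
  upByN _             n = []

  upByE : ℕ → ℕ → List (List Step)
  upByE (suc k) (suc n) = map (_∷ʳ E) (endingDown k n)
  upByE _       _       = []

  endingDown : ℕ → ℕ → List (List Step)
  endingDown k zero    = emptyPath k
  endingDown k (suc n) = map (_∷ʳ N̄) (endingUp (suc (suc k)) n) ++ downByĒ k n

  downByĒ : ℕ → ℕ → List (List Step)
  downByĒ k zero    = []
  downByĒ k (suc n) = map (_∷ʳ Ē) (endingUp (suc k) n)

mutual
  endingUp-sound : ∀ k n {p} → p ∈ endingUp k n → EndingUp k n p
  endingUp-sound k (suc n) p∈ with ∈-++⁻ (upByN k n) p∈
  ... | inj₁ p∈N = upByN-sound k n p∈N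
  ... | inj₂ p∈E = upByE-sound k n p∈E

  upByN-sound : ∀ k n {p} → p ∈ upByN k n → EndingUp k (suc n) p
  upByN-sound (suc (suc k)) n p∈ with ∈-map⁻ (_∷ʳ N) p∈
  ... | q , q∈ , refl = let r , last = endingDown-sound k n q∈ in
                        Reaches-∷ʳ⁺ N r last refl , q , N , refl , refl

  upByE-sound : ∀ k n {p} → p ∈ upByE k n → EndingUp k (suc n) p
  upByE-sound (suc k) (suc n) p∈ with ∈-map⁻ (_∷ʳ E) p∈
  ... | q , q∈ , refl = let r , last = endingDown-sound k n q∈ in
                        Reaches-∷ʳ⁺ E r last refl , q , E , refl , refl

  endingDown-sound : ∀ k n {p} → p ∈ endingDown k n → EndingDown k n p
  endingDown-sound zero    zero    (here refl) = ((tt , tt) , refl , refl) , inj₂ refl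
  endingDown-sound k       (suc n) p∈ with ∈-++⁻ (map (_∷ʳ N̄) (endingUp (suc (suc k)) n)) p∈
  ... | inj₁ p∈N̄ with ∈-map⁻ (_∷ʳ N̄) p∈N̄
  ...   | q , q∈ , refl = let r , last = endingUp-sound (suc (suc k)) n q∈ in
                          Reaches-∷ʳ⁺ N̄ r (inj₁ last) refl , inj₁ (q , N̄ , refl , refl)
  endingDown-sound k (suc n) p∈ | inj₂ p∈Ē = downByĒ-sound k n p∈Ē

  downByĒ-sound : ∀ k n {p} → p ∈ downByĒ k n → EndingDown k (suc n) p
  downByĒ-sound k (suc n) p∈ with ∈-map⁻ (_∷ʳ Ē) p∈
  ... | q , q∈ , refl = let r , last = endingUp-sound (suc k) n q∈ in
                        Reaches-∷ʳ⁺ Ē r (inj₁ last) refl , inj₁ (q , Ē , refl , refl)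

mutual
  endingUp-complete : ∀ k n {p} → EndingUp k n p → p ∈ endingUp k n
  endingUp-complete k n (r , q , s , refl , up≡) = ∷ʳ-up-complete k n q s up≡ r

  ∷ʳ-up-complete : ∀ k n q s → up s ≡ true → Reaches k n (q ∷ʳ s) → q ∷ʳ s ∈ endingUp k n
  ∷ʳ-up-complete k zero q N _ (_ , sz , _) with subst (1 ℕ.≤_) sz (dx≤size-∷ʳ q N)
  ... | ()
  ∷ʳ-up-complete k (suc n) q N _ r with Reaches-∷ʳ⁻ N r
  ... | j , rq , last , ht with ℤP.+-injective ht
  ...   | refl = ∈-++⁺ˡ (∈-map⁺ (_∷ʳ N) (endingDown-complete j n (rq , last)))
  ∷ʳ-up-complete k zero q E _ (_ , sz , _) with subst (2 ℕ.≤_) sz (dx≤size-∷ʳ q E)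
  ... | ()
  ∷ʳ-up-complete k (suc zero) q E _ (_ , sz , _) with subst (2 ℕ.≤_) sz (dx≤size-∷ʳ q E)
  ... | s≤s ()
  ∷ʳ-up-complete k (suc (suc n)) q E _ r with Reaches-∷ʳ⁻ E r
  ... | j , rq , last , ht with ℤP.+-injective ht
  ...   | refl = ∈-++⁺ʳ (upByN (suc j) (suc n)) (∈-map⁺ (_∷ʳ E) (endingDown-complete j n (rq , last)))

  endingDown-complete : ∀ k n {p} → EndingDown k n p → p ∈ endingDown k n
  endingDown-complete k n ((_ , refl , refl) , inj₂ refl)       = here refl
  endingDown-complete k n (r , inj₁ (q , s , refl , down≡)) = ∷ʳ-down-complete k n q s down≡ r

  ∷ʳ-down-complete : ∀ k n q s → up s ≡ false → Reaches k n (q ∷ʳ s) → q ∷ʳ s ∈ endingDown k n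
  ∷ʳ-down-complete k zero q N̄ _ (_ , sz , _) with subst (1 ℕ.≤_) sz (dx≤size-∷ʳ q N̄)
  ... | ()
  ∷ʳ-down-complete k (suc n) q N̄ _ r with Reaches-∷ʳ⁻ N̄ r
  ... | j , (_ , _ , refl) , inj₂ refl , ()
  ... | j , rq , inj₁ last , ht with -[1+d]+j≡k⇒j≡1+d+k 1 j k ht
  ...   | refl = ∈-++⁺ˡ (∈-map⁺ (_∷ʳ N̄) (endingUp-complete (suc (suc k)) n (rq , last)))
  ∷ʳ-down-complete k zero q Ē _ (_ , sz , _) with subst (2 ℕ.≤_) sz (dx≤size-∷ʳ q Ē)
  ... | ()
  ∷ʳ-down-complete k (suc zero) q Ē _ (_ , sz , _) with subst (2 ℕ.≤_) sz (dx≤size-∷ʳ q Ē)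
  ... | s≤s ()
  ∷ʳ-down-complete k (suc (suc n)) q Ē _ r with Reaches-∷ʳ⁻ Ē r
  ... | j , (_ , _ , refl) , inj₂ refl , ()
  ... | j , rq , inj₁ last , ht with -[1+d]+j≡k⇒j≡1+d+k 0 j k ht
  ...   | refl = ∈-++⁺ʳ (map (_∷ʳ N̄) (endingUp (suc (suc k)) (suc n)))
                        (∈-map⁺ (_∷ʳ Ē) (endingUp-complete (suc k) n (rq , last)))

EndsWith : Step → List Step → Set
EndsWith s p = ∃ λ q → p ≡ q ∷ʳ s

∈-map-∷ʳ⇒EndsWith : ∀ s ps {p} → p ∈ map (_∷ʳ s) ps → EndsWith s p
∈-map-∷ʳ⇒EndsWith s ps p∈ = let q , _ , p≡ = ∈-map⁻ (_∷ʳ s) p∈ in q , p≡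

EndsWith-disjoint : ∀ {s t p} → s ≢ t → EndsWith s p → EndsWith t p → ⊥
EndsWith-disjoint s≢t (q , refl) (q′ , eq) = s≢t (LP.∷ʳ-injectiveʳ q q′ eq)

upByN-endsWith : ∀ k n {p} → p ∈ upByN k n → EndsWith N p
upByN-endsWith (suc (suc k)) n = ∈-map-∷ʳ⇒EndsWith N _

upByE-endsWith : ∀ k n {p} → p ∈ upByE k n → EndsWith E p
upByE-endsWith (suc k) (suc n) = ∈-map-∷ʳ⇒EndsWith E _

downByĒ-endsWith : ∀ k n {p} → p ∈ downByĒ k n → EndsWith Ē p
downByĒ-endsWith k (suc n) = ∈-map-∷ʳ⇒EndsWith Ē _

∷ʳ-injectiveˡ : ∀ s {q q′ : List Step} → q ∷ʳ s ≡ q′ ∷ʳ s → q ≡ q′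
∷ʳ-injectiveˡ s {q} {q′} = LP.∷ʳ-injectiveˡ q q′

mutual
  endingUp-unique : ∀ k n → Unique (endingUp k n)
  endingUp-unique k zero    = []
  endingUp-unique k (suc n) = Unique.++⁺ (upByN-unique k n) (upByE-unique k n)
    (λ (p∈N , p∈E) → EndsWith-disjoint (λ ()) (upByN-endsWith k n p∈N) (upByE-endsWith k n p∈E))

  upByN-unique : ∀ k n → Unique (upByN k n)
  upByN-unique zero          n = []
  upByN-unique (suc zero)    n = []
  upByN-unique (suc (suc k)) n = Unique.map⁺ (∷ʳ-injectiveˡ N) (endingDown-unique k n)

  upByE-unique : ∀ k n → Unique (upByE k n)
  upByE-unique zero    n       = []
  upByE-unique (suc k) zero    = []
  upByE-unique (suc k) (suc n) = Unique.map⁺ (∷ʳ-injectiveˡ E) (endingDown-unique k n)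

  endingDown-unique : ∀ k n → Unique (endingDown k n)
  endingDown-unique k zero    = emptyPath-unique k
  endingDown-unique k (suc n) =
    Unique.++⁺ (Unique.map⁺ (∷ʳ-injectiveˡ N̄) (endingUp-unique (suc (suc k)) n)) (downByĒ-unique k n)
      (λ (p∈N̄ , p∈Ē) →
         EndsWith-disjoint (λ ()) (∈-map-∷ʳ⇒EndsWith N̄ _ p∈N̄) (downByĒ-endsWith k n p∈Ē))

  downByĒ-unique : ∀ k n → Unique (downByĒ k n)
  downByĒ-unique k zero    = []
  downByĒ-unique k (suc n) = Unique.map⁺ (∷ʳ-injectiveˡ Ē) (endingUp-unique (suc k) n)

fPaths gPaths : ℕ → ℕ → List (List Step)
fPaths k zero    = emptyPath k
fPaths k (suc n) = endingUp k (suc n)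
gPaths k zero    = []
gPaths k (suc n) = endingDown k (suc n)

emptyPath-sound : ∀ k {p} → p ∈ emptyPath k → p ≡ [] × k ≡ 0
emptyPath-sound zero (here refl) = refl , refl

0<size-∷ʳ : ∀ q s → 0 ℕ.< size (q ∷ʳ s)
0<size-∷ʳ q s = ℕP.<-≤-trans (0<dx s) (dx≤size-∷ʳ q s)
  where
  0<dx : ∀ s → 0 ℕ.< dx s
  0<dx N = s≤s z≤n
  0<dx N̄ = s≤s z≤n
  0<dx E = s≤s z≤n
  0<dx Ē = s≤s z≤n

LastDir⇒size≢0 : ∀ {b p} → LastDir b p → size p ≢ 0
LastDir⇒size≢0 (q , s , refl , _) size≡0 = ℕP.<⇒≢ (0<size-∷ʳ q s) (sym size≡0)

fPaths-sound : ∀ k n {p} → p ∈ fPaths k n → FPaths k n p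
fPaths-sound k zero    p∈ with emptyPath-sound k p∈
... | refl , refl = Admissible⇒PartialZigzag [] (tt , tt) , refl , refl , inj₂ refl
fPaths-sound k (suc n) p∈ with endingUp-sound k (suc n) p∈
... | (adm , sz , ht) , last = Admissible⇒PartialZigzag _ adm , sz , ht , inj₁ last

fPaths-complete : ∀ k n {p} → FPaths k n p → p ∈ fPaths k n
fPaths-complete k zero    (_ , _ , refl , inj₂ refl)  = here refl
fPaths-complete k zero    (_ , sz , _ , inj₁ last)    = ⊥-elim (LastDir⇒size≢0 last sz)
fPaths-complete k (suc n) (_ , () , _ , inj₂ refl)
fPaths-complete k (suc n) (pz , sz , ht , inj₁ last) =
  endingUp-complete k (suc n) ((PartialZigzag⇒Admissible _ pz , sz , ht) , last)

gPaths-sound : ∀ k n {p} → p ∈ gPaths k n → GPaths k n p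
gPaths-sound k (suc n) p∈ with endingDown-sound k (suc n) p∈
... | (adm , sz , ht) , inj₁ last = Admissible⇒PartialZigzag _ adm , sz , ht , last
... | (adm , () , ht) , inj₂ refl

gPaths-complete : ∀ k n {p} → GPaths k n p → p ∈ gPaths k n
gPaths-complete k zero    (_ , sz , _ , last)       = ⊥-elim (LastDir⇒size≢0 last sz)
gPaths-complete k (suc n) (pz , sz , ht , last) =
  endingDown-complete k (suc n) ((PartialZigzag⇒Admissible _ pz , sz , ht) , inj₁ last)

fPaths-count : ∀ k n → IsCount (FPaths k n) (length (fPaths k n))
fPaths-count k n = fPaths k n , refl , unique k n , λ p → fPaths-sound k n , fPaths-complete k n
  where
  unique : ∀ k n → Unique (fPaths k n)
  unique k zero    = emptyPath-unique k
  unique k (suc n) = endingUp-unique k (suc n)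

gPaths-count : ∀ k n → IsCount (GPaths k n) (length (gPaths k n))
gPaths-count k n = gPaths k n , refl , unique k n , λ p → gPaths-sound k n , gPaths-complete k n
  where
  unique : ∀ k n → Unique (gPaths k n)
  unique k zero    = []
  unique k (suc n) = endingDown-unique k (suc n)

module _ {A : Set} where

  ∈-─⁺ : ∀ {x y : A} {xs} (x∈ : x ∈ xs) → y ∈ xs → y ≢ x → y ∈ xs ─ x∈
  ∈-─⁺ (here refl) (here refl) y≢x = ⊥-elim (y≢x refl)
  ∈-─⁺ (here refl) (there y∈)  _   = y∈
  ∈-─⁺ (there x∈)  (here refl) _   = here refl
  ∈-─⁺ (there x∈)  (there y∈)  y≢x = there (∈-─⁺ x∈ y∈ y≢x)

  Unique-⊆⇒length≤ : ∀ {xs ys : List A} → Unique xs → (∀ {v} → v ∈ xs → v ∈ ys) →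
                     length xs ℕ.≤ length ys
  Unique-⊆⇒length≤ {[]}     _             _  = z≤n
  Unique-⊆⇒length≤ {x ∷ xs} {ys} (x∉ ∷ u) xs⊆ys =
    subst (length (x ∷ xs) ℕ.≤_) (sym (LP.length-removeAt′ ys (Any.index x∈ys)))
      (s≤s (Unique-⊆⇒length≤ u (λ v∈ → ∈-─⁺ x∈ys (xs⊆ys (there v∈)) (All-≢ x∉ v∈))))
    where
    x∈ys : x ∈ ys
    x∈ys = xs⊆ys (here refl)
    All-≢ : ∀ {v xs} → All (x ≢_) xs → v ∈ xs → v ≢ x
    All-≢ (x≢v ∷ _)  (here refl) = x≢v ∘ sym
    All-≢ (_ ∷ x≢vs) (there v∈)  = All-≢ x≢vs v∈

IsCount-unique : ∀ {P m m′} → IsCount P m → IsCount P m′ → m ≡ m′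
IsCount-unique (L , refl , u , L⇔P) (L′ , refl , u′ , L′⇔P) = ℕP.≤-antisym
  (Unique-⊆⇒length≤ u  (λ {v} v∈ → proj₂ (L′⇔P v) (proj₁ (L⇔P v) v∈)))
  (Unique-⊆⇒length≤ u′ (λ {v} v∈ → proj₂ (L⇔P v) (proj₁ (L′⇔P v) v∈)))

-- Counting series

δ : ℕ → PS
δ k = cst (iv0 k)

δ-suc : ∀ k → δ (suc k) ≈ 0ˢ
δ-suc k zero    = refl
δ-suc k (suc n) = refl

up# down# : ℕ → PS
up#   k n = + length (endingUp k n)
down# k n = + length (endingDown k n)

up#-zero : up# 0 ≈ 0ˢ
up#-zero zero    = refl
up#-zero (suc n) = refl

up#-suc : ∀ j → up# (suc j) ≈ X ⊛ (below 0ˢ down# j ⊕ X ⊛ down# j)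
up#-suc j zero    = refl
up#-suc j (suc n) = begin
  + length (upByN (suc j) n ++ upByE (suc j) n)            ≡⟨ cong +_ (LP.length-++ (upByN (suc j) n)) ⟩
  + length (upByN (suc j) n) + + length (upByE (suc j) n)  ≡⟨ cong₂ _+_ (viaN j) (viaE n) ⟩
  below 0ˢ down# j n + (X ⊛ down# j) n                     ≡⟨ X⊛-suc (below 0ˢ down# j ⊕ X ⊛ down# j) n ⟨
  (X ⊛ (below 0ˢ down# j ⊕ X ⊛ down# j)) (suc n)           ∎
  where
  open ≡-Reasoning
  viaN : ∀ j → + length (upByN (suc j) n) ≡ below 0ˢ down# j n
  viaN zero    = refl
  viaN (suc j) = cong +_ (LP.length-map (_∷ʳ N) (endingDown j n))
  viaE : ∀ n → + length (upByE (suc j) n) ≡ (X ⊛ down# j) n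
  viaE zero    = refl
  viaE (suc n) = trans (cong +_ (LP.length-map (_∷ʳ E) (endingDown j n))) (sym (X⊛-suc (down# j) n))

down#-eq : ∀ k → down# k ≈ δ k ⊕ X ⊛ (up# (suc (suc k)) ⊕ X ⊛ up# (suc k))
down#-eq zero    zero    = refl
down#-eq (suc k) zero    = refl
down#-eq k       (suc n) = begin
  + length (map (_∷ʳ N̄) (endingUp (suc (suc k)) n) ++ downByĒ k n)
    ≡⟨ cong +_ (LP.length-++ (map (_∷ʳ N̄) (endingUp (suc (suc k)) n))) ⟩
  + length (map (_∷ʳ N̄) (endingUp (suc (suc k)) n)) + + length (downByĒ k n)
    ≡⟨ cong₂ _+_ (cong +_ (LP.length-map (_∷ʳ N̄) (endingUp (suc (suc k)) n))) (viaĒ n) ⟩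
  up# (suc (suc k)) n + (X ⊛ up# (suc k)) n
    ≡⟨ X⊛-suc (up# (suc (suc k)) ⊕ X ⊛ up# (suc k)) n ⟨
  (X ⊛ (up# (suc (suc k)) ⊕ X ⊛ up# (suc k))) (suc n)
    ≡⟨ ℤP.+-identityˡ _ ⟨
  (δ k ⊕ X ⊛ (up# (suc (suc k)) ⊕ X ⊛ up# (suc k))) (suc n)
    ∎
  where
  open ≡-Reasoning
  viaĒ : ∀ n → + length (downByĒ k n) ≡ (X ⊛ up# (suc k)) n
  viaĒ zero    = refl
  viaĒ (suc n) = trans (cong +_ (LP.length-map (_∷ʳ Ē) (endingUp (suc k) n))) (sym (X⊛-suc (up# (suc k)) n))

H : ℕ → PS
H k = X ^ˢ 3 ⊛ down# k

below-H : ∀ k → below 1ˢ H k ≈ δ k ⊕ X ^ˢ 3 ⊛ below 0ˢ down# k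
below-H zero    = ≈-sym (⊕-identityʳ′ (⊛-≈0ʳ (X ^ˢ 3) ≈-refl))
below-H (suc k) = ≈-sym (≈-trans (⊕-cong (δ-suc k) ≈-refl) (λ n → ℤP.+-identityˡ (H k n)))

H-KernelEq : KernelEq 1ˢ H
H-KernelEq k = begin
  X ^ˢ 3 ⊛ down# k
    ≈⟨ ⊛-congˡ (X ^ˢ 3) (down#-eq k) ⟩
  X ^ˢ 3 ⊛ (δ k ⊕ X ⊛ (up# (suc (suc k)) ⊕ X ⊛ up# (suc k)))
    ≈⟨ ⊛-congˡ (X ^ˢ 3) (⊕-cong (≈-refl {δ k})
                            (⊛-congˡ X (⊕-cong (up#-suc (suc k)) (⊛-congˡ X (up#-suc k))))) ⟩
  X ^ˢ 3 ⊛ (δ k ⊕ X ⊛ (X ⊛ (down# k ⊕ X ⊛ down# (suc k))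
                       ⊕ X ⊛ (X ⊛ (below 0ˢ down# k ⊕ X ⊛ down# k))))
    ≈⟨ solve 5 (λ x e d d′ b →
         x :^ 3 :* (e :+ x :* (x :* (d :+ x :* d′) :+ x :* (x :* (b :+ x :* d))))
           := x :* ((x :+ x :^ 3) :* (x :^ 3 :* d) :+ x :^ 2 :* (x :^ 3 :* d′ :+ (e :+ x :^ 3 :* b))))
         ≈-refl X (δ k) (down# k) (down# (suc k)) (below 0ˢ down# k) ⟩
  X ⊛ ((X ⊕ X ^ˢ 3) ⊛ H k ⊕ X ^ˢ 2 ⊛ (H (suc k) ⊕ (δ k ⊕ X ^ˢ 3 ⊛ below 0ˢ down# k)))
    ≈⟨ ⊛-congˡ X (kernel-below k (below-H k)) ⟨
  X ⊛ kernel 1ˢ H k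
    ∎
  where open ≈-Reasoning

fPaths-length : ∀ k → (λ n → + length (fPaths k n)) ≈ up# k ⊕ δ k
fPaths-length zero    zero    = refl
fPaths-length (suc k) zero    = refl
fPaths-length k       (suc n) = sym (ℤP.+-identityʳ _)

gPaths-length : ∀ k → (λ n → + length (gPaths k n)) ⊕ δ k ≈ down# k
gPaths-length zero    zero    = refl
gPaths-length (suc k) zero    = refl
gPaths-length k       (suc n) = ℤP.+-identityʳ _

genFun-f : ∀ {f} → (∀ k n → IsCount (FPaths k n) (f k n)) → ∀ k → genFun f k ≈ up# k ⊕ δ k
genFun-f f-count k n = trans (cong +_ (IsCount-unique (f-count k n) (fPaths-count k n))) (fPaths-length k n)

genFun-g : ∀ {g} → (∀ k n → IsCount (GPaths k n) (g k n)) → ∀ k → genFun g k ⊕ δ k ≈ down# k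
genFun-g g-count k n =
  trans (cong (λ m → + m + δ k n) (IsCount-unique (g-count k n) (gPaths-count k n))) (gPaths-length k n)

-- Bivariate series

sumTo-upTo1 : ∀ k (f : ℕ → ℤ) → (∀ i → f (suc (suc i)) ≡ + 0) → sumTo (suc k) f ≡ f 0 + f 1
sumTo-upTo1 zero    f _   = refl
sumTo-upTo1 (suc k) f f≡0 = trans (cong₂ _+_ (sumTo-upTo1 k f f≡0) (f≡0 k)) (ℤP.+-identityʳ _)

⊛₂-suc : ∀ P Y k → (∀ i → P (suc (suc i)) ≈ 0ˢ) →
         (P ⊛₂ Y) (suc k) ≈ P 0 ⊛ Y (suc k) ⊕ P 1 ⊛ Y k
⊛₂-suc P Y k P≈0 n =
  sumTo-upTo1 k _ (λ i → trans (⊛-congʳ (Y (k ∸ suc i)) (P≈0 i) n) (⊛-zeroˡ (Y (k ∸ suc i)) n))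

lift-⊛₂ : ∀ a B k → (lift a ⊛₂ B) k ≈ a ⊛ B k
lift-⊛₂ a B zero    = ≈-refl
lift-⊛₂ a B (suc k) = ≈-trans (⊛₂-suc (lift a) B k (λ i → ≈-refl)) (⊕-identityʳ′ (⊛-zeroˡ (B k)))

uMono-⊛₂ : ∀ c V k → (uMono c 1 ⊛₂ V) k ≈ below 0ˢ (λ k → c ⊛ V k) k
uMono-⊛₂ c V zero    = ⊛-zeroˡ (V 0)
uMono-⊛₂ c V (suc k) = ≈-trans (⊛₂-suc (uMono c 1) V k (λ i → ≈-refl))
  (λ n → trans (cong (_+ (c ⊛ V k) n) (⊛-zeroˡ (V (suc k)) n)) (ℤP.+-identityˡ _))

lift-1ˢ : ∀ k → lift 1ˢ k ≈ δ k
lift-1ˢ zero    = ≈-refl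
lift-1ˢ (suc k) = ≈-sym (δ-suc k)

one-minus-ru : PS → BPS
one-minus-ru r = lift 1ˢ ⊖₂ uMono r 1

lift⊛₂one-minus-ru-0 : ∀ a r → (lift a ⊛₂ one-minus-ru r) 0 ≈ a
lift⊛₂one-minus-ru-0 a r = ≈-trans (⊛-congˡ a (λ n → ℤP.+-identityʳ (1ˢ n))) (⊛-identityʳ a)

times-one-minus-ru : ∀ {a r Y V} (y : ℕ → PS) → (∀ k → a ⊛ Y k ≈ y k) →
                     y 0 ≈ V 0 → (∀ k → y (suc k) ⊖ r ⊛ y k ≈ V (suc k)) →
                     lift a ⊛₂ one-minus-ru r ⊛₂ Y ≈₂ V
times-one-minus-ru {a} {r} {Y} y aY≈y y₀≈V₀ step zero =
  ≈-trans (⊛-congʳ (Y 0) (lift⊛₂one-minus-ru-0 a r)) (≈-trans (aY≈y 0) y₀≈V₀)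
times-one-minus-ru {a} {r} {Y} y aY≈y y₀≈V₀ step (suc k) = begin
  (L ⊛₂ Y) (suc k)
    ≈⟨ ⊛₂-suc L Y k L≥2≈0 ⟩
  L 0 ⊛ Y (suc k) ⊕ L 1 ⊛ Y k
    ≈⟨ ⊕-cong (⊛-congʳ (Y (suc k)) (lift⊛₂one-minus-ru-0 a r)) (⊛-congʳ (Y k) L₁≈-ar) ⟩
  a ⊛ Y (suc k) ⊕ a ⊛ (-ˢ r) ⊛ Y k
    ≈⟨ solve 4 (λ a r y y′ → a :* y′ :+ a :* (:- r) :* y := a :* y′ :- r :* (a :* y)) ≈-refl a r (Y k) (Y (suc k)) ⟩
  a ⊛ Y (suc k) ⊖ r ⊛ (a ⊛ Y k)
    ≈⟨ ⊖-cong (aY≈y (suc k)) (⊛-congˡ r (aY≈y k)) ⟩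
  y (suc k) ⊖ r ⊛ y k
    ≈⟨ step k ⟩
  _ ∎
  where
  open ≈-Reasoning
  L : BPS
  L = lift a ⊛₂ one-minus-ru r
  L₁≈-ar : L 1 ≈ a ⊛ (-ˢ r)
  L₁≈-ar = ≈-trans (lift-⊛₂ a (one-minus-ru r) 1) (⊛-congˡ a (λ n → ℤP.+-identityˡ (- r n)))
  L≥2≈0 : ∀ i → L (suc (suc i)) ≈ 0ˢ
  L≥2≈0 i = ≈-trans (lift-⊛₂ a (one-minus-ru r) (suc (suc i))) (⊛-≈0ʳ a (λ n → refl))

-- z² (f_k − [k = 0]); the constant 0 is cst (+ 0), as the ring solver writes it.
z²f : PS → ℕ → PS
z²f r zero    = cst (+ 0)
z²f r (suc j) = (r ⊛ X ⊕ 1ˢ) ⊛ r ^ˢ j ⊖ δ j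

z²f-sucᵖ : ∀ {m} → Polynomial m → Polynomial m → Polynomial m → Polynomial m → Polynomial m
z²f-sucᵖ x r p e = (r :* x :+ con (+ 1)) :* p :- e

module ClosedForms {r : PS} (r-root : Quadratic r ≈ 0ˢ) where

  H≈powers : ∀ k → H k ≈ r ^ˢ suc k
  H≈powers = KernelEq-unique H-KernelEq (powers-KernelEq {r} r-root)

  X²⊛up#≈z²f : ∀ k → X ^ˢ 2 ⊛ up# k ≈ z²f r k
  X²⊛up#≈z²f zero    = ≈-trans (⊛-≈0ʳ (X ^ˢ 2) up#-zero) (≈-sym cst0≈0ˢ)
  X²⊛up#≈z²f (suc j) = begin
    X ^ˢ 2 ⊛ up# (suc j)
      ≈⟨ ⊛-congˡ (X ^ˢ 2) (up#-suc j) ⟩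
    X ^ˢ 2 ⊛ (X ⊛ (below 0ˢ down# j ⊕ X ⊛ down# j))
      ≈⟨ solve 4 (λ x b d e → x :^ 2 :* (x :* (b :+ x :* d)) := (e :+ x :^ 3 :* b) :- e :+ x :* (x :^ 3 :* d))
                  ≈-refl X (below 0ˢ down# j) (down# j) (δ j) ⟩
    (δ j ⊕ X ^ˢ 3 ⊛ below 0ˢ down# j) ⊖ δ j ⊕ X ⊛ H j
      ≈⟨ ⊕-cong (⊖-cong (≈-trans (≈-sym (below-H j)) (below-powers j)) (≈-refl {δ j}))
                (⊛-congˡ X (H≈powers j)) ⟩
    r ^ˢ j ⊖ δ j ⊕ X ⊛ (r ⊛ r ^ˢ j)
      ≈⟨ solve 4 (λ x r p e → p :- e :+ x :* (r :* p) := z²f-sucᵖ x r p e) ≈-refl X r (r ^ˢ j) (δ j) ⟩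
    z²f r (suc j)
      ∎
    where
    open ≈-Reasoning
    below-powers : ∀ j → below 1ˢ H j ≈ r ^ˢ j
    below-powers zero    = ≈-refl
    below-powers (suc j) = H≈powers j

  module Counted {f g : ℕ → ℕ → ℕ} (f-count : ∀ k n → IsCount (FPaths k n) (f k n))
                                   (g-count : ∀ k n → IsCount (GPaths k n) (g k n)) where

    X³⊛g+δ≈powers : ∀ k → X ^ˢ 3 ⊛ (genFun g k ⊕ δ k) ≈ r ^ˢ suc k
    X³⊛g+δ≈powers k = ≈-trans (⊛-congˡ (X ^ˢ 3) (genFun-g g-count k)) (H≈powers k)

    f₀≈1 : genFun f 0 ≈ 1ˢ
    f₀≈1 = ≈-trans (genFun-f f-count 0) (λ n → trans (cong (_+ 1ˢ n) (up#-zero n)) (ℤP.+-identityˡ (1ˢ n)))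

    z²f-suc : ∀ j → z^ 2 ⊛ genFun f (suc j) ≈ z²f r (suc j)
    z²f-suc j = ≈-trans (⊛-cong (z^≈X^ 2) f≈up#) (X²⊛up#≈z²f (suc j))
      where
      f≈up# : genFun f (suc j) ≈ up# (suc j)
      f≈up# = ≈-trans (genFun-f f-count (suc j)) (⊕-identityʳ′ (δ-suc j))

    z³g₀ : z^ 3 ⊛ genFun g 0 ≈ r ⊖ z^ 3
    z³g₀ = begin
      z^ 3 ⊛ genFun g 0
        ≈⟨ ⊛-congʳ (genFun g 0) (z^≈X^ 3) ⟩
      X ^ˢ 3 ⊛ genFun g 0
        ≈⟨ solve 2 (λ x g → x :^ 3 :* g := x :^ 3 :* (g :+ con (+ 1)) :- x :^ 3) ≈-refl X (genFun g 0) ⟩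
      X ^ˢ 3 ⊛ (genFun g 0 ⊕ δ 0) ⊖ X ^ˢ 3
        ≈⟨ ⊖-cong (≈-trans (X³⊛g+δ≈powers 0) (⊛-identityʳ r)) (≈-sym (z^≈X^ 3)) ⟩
      r ⊖ z^ 3
        ∎
      where open ≈-Reasoning

    z³g-suc : ∀ j → z^ 3 ⊛ genFun g (suc j) ≈ r ^ˢ suc (suc j)
    z³g-suc j = ≈-trans (⊛-cong (z^≈X^ 3) (≈-sym (⊕-identityʳ′ {genFun g (suc j)} (δ-suc j))))
                        (X³⊛g+δ≈powers (suc j))

    F-equation : lift (z^ 2) ⊛₂ one-minus-ru r ⊛₂ (genFun f ⊖₂ lift 1ˢ)
                 ≈₂ uMono r 1 ⊛₂ (uMono 1ˢ 1 ⊕₂ lift X)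
    F-equation = times-one-minus-ru {Y = genFun f ⊖₂ lift 1ˢ} (z²f r) z²F≈z²f
                   (≈-sym (≈-trans (uMono-⊛₂ r W 0) (≈-sym cst0≈0ˢ)))
                   (λ k → ≈-trans (step k) (≈-sym (uMono-⊛₂ r W (suc k))))
      where
      W : BPS
      W = uMono 1ˢ 1 ⊕₂ lift X
      z²F≈z²f : ∀ k → z^ 2 ⊛ (genFun f k ⊖ lift 1ˢ k) ≈ z²f r k
      z²F≈z²f k = ≈-trans (⊛-cong (z^≈X^ 2) F≈up#) (X²⊛up#≈z²f k)
        where
        F≈up# : genFun f k ⊖ lift 1ˢ k ≈ up# k
        F≈up# = ≈-trans (⊖-cong (genFun-f f-count k) (lift-1ˢ k))
                        (solve 2 (λ u e → u :+ e :- e := u) ≈-refl (up# k) (δ k))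
      step : ∀ k → z²f r (suc k) ⊖ r ⊛ z²f r k ≈ r ⊛ W k
      step zero          =
        ≈-trans (solve 2 (λ x r → z²f-sucᵖ x r (con (+ 1)) (con (+ 1)) :- r :* con (+ 0) := r :* x) ≈-refl X r)
                (⊛-congˡ r (λ n → sym (ℤP.+-identityˡ (X n))))
      step (suc zero)    =
        ≈-trans (solve 2 (λ x r → z²f-sucᵖ x r (r :* con (+ 1)) (con (+ 0))
                                    :- r :* z²f-sucᵖ x r (con (+ 1)) (con (+ 1)) := r :* con (+ 1)) ≈-refl X r)
                (⊛-congˡ r (λ n → sym (ℤP.+-identityʳ (1ˢ n))))
      step (suc (suc i)) =
        ≈-trans (solve 3 (λ x r p → z²f-sucᵖ x r (r :* (r :* p)) (con (+ 0))
                                      :- r :* z²f-sucᵖ x r (r :* p) (con (+ 0)) := r :* con (+ 0)) ≈-refl X r (r ^ˢ i))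
                (⊛-congˡ r {cst (+ 0)} {W (suc (suc i))} λ { zero → refl ; (suc n) → refl })

    G-equation : lift (z^ 3) ⊛₂ one-minus-ru r ⊛₂ (genFun g ⊕₂ lift 1ˢ) ≈₂ lift r
    G-equation = times-one-minus-ru {Y = genFun g ⊕₂ lift 1ˢ} (λ k → r ^ˢ suc k) z³G≈powers
                   (⊛-identityʳ r) (λ k → ≈⇒⊖≈0 (≈-refl {r ^ˢ suc (suc k)}))
      where
      z³G≈powers : ∀ k → z^ 3 ⊛ (genFun g k ⊕ lift 1ˢ k) ≈ r ^ˢ suc k
      z³G≈powers k =
        ≈-trans (⊛-cong (z^≈X^ 3) (⊕-cong (≈-refl {genFun g k}) (lift-1ˢ k))) (X³⊛g+δ≈powers k)

    FG-equation : lift (z^ 3) ⊛₂ one-minus-ru r ⊛₂ (genFun f ⊕₂ genFun g)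
                  ≈₂ uMono (r ⊛ X) 2 ⊕₂ uMono (r ⊛ z^ 2) 1 ⊕₂ lift r
    FG-equation = times-one-minus-ru {Y = genFun f ⊕₂ genFun g} y z³FG≈y
                    (≈-trans (solve 2 (λ x r → x :* con (+ 0) :+ r :* con (+ 1) := r) ≈-refl X r)
                             (λ n → sym (ℤP.+-identityˡ (r n))))
                    step
      where
      y : ℕ → PS
      y k = X ⊛ z²f r k ⊕ r ^ˢ suc k
      z³FG≈y : ∀ k → z^ 3 ⊛ (genFun f k ⊕ genFun g k) ≈ y k
      z³FG≈y k = begin
        z^ 3 ⊛ (genFun f k ⊕ genFun g k)
          ≈⟨ ⊛-cong (z^≈X^ 3) (⊕-cong (genFun-f f-count k) (≈-refl {genFun g k})) ⟩
        X ^ˢ 3 ⊛ ((up# k ⊕ δ k) ⊕ genFun g k)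
          ≈⟨ solve 4 (λ x u e g → x :^ 3 :* ((u :+ e) :+ g) := x :* (x :^ 2 :* u) :+ x :^ 3 :* (g :+ e))
                      ≈-refl X (up# k) (δ k) (genFun g k) ⟩
        X ⊛ (X ^ˢ 2 ⊛ up# k) ⊕ X ^ˢ 3 ⊛ (genFun g k ⊕ δ k)
          ≈⟨ ⊕-cong (⊛-congˡ X (X²⊛up#≈z²f k)) (X³⊛g+δ≈powers k) ⟩
        y k
          ∎
        where open ≈-Reasoning
      step : ∀ k → y (suc k) ⊖ r ⊛ y k ≈ (uMono (r ⊛ X) 2 ⊕₂ uMono (r ⊛ z^ 2) 1 ⊕₂ lift r) (suc k)
      step zero          =
        ≈-trans (solve 2 (λ x r → x :* z²f-sucᵖ x r (con (+ 1)) (con (+ 1)) :+ r :* (r :* con (+ 1))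
                                    :- r :* (x :* con (+ 0) :+ r :* con (+ 1)) := r :* x :^ 2) ≈-refl X r)
                (λ n → trans (⊛-congˡ r (≈-sym (z^≈X^ 2)) n)
                             (sym (trans (ℤP.+-identityʳ _) (ℤP.+-identityˡ _))))
      step (suc zero)    =
        ≈-trans (solve 2 (λ x r → x :* z²f-sucᵖ x r (r :* con (+ 1)) (con (+ 0)) :+ r :* (r :* (r :* con (+ 1)))
                                    :- r :* (x :* z²f-sucᵖ x r (con (+ 1)) (con (+ 1)) :+ r :* (r :* con (+ 1)))
                                    := r :* x) ≈-refl X r)
                (λ n → sym (trans (ℤP.+-identityʳ _) (ℤP.+-identityʳ _)))
      step (suc (suc i)) =
        ≈-trans (solve 3 (λ x r p → x :* z²f-sucᵖ x r (r :* (r :* p)) (con (+ 0)) :+ r :* (r :* (r :* (r :* p)))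
                                      :- r :* (x :* z²f-sucᵖ x r (r :* p) (con (+ 0)) :+ r :* (r :* (r :* p)))
                                      := con (+ 0)) ≈-refl X r (r ^ˢ i))
                cst0≈0ˢ

theorem1 :
    (Σ PS λ s → Σ PS λ r → Σ (ℕ → ℕ → ℕ) λ f → Σ (ℕ → ℕ → ℕ) λ g →
       IsR s r × (∀ k n → IsCount (FPaths k n) (f k n))
               × (∀ k n → IsCount (GPaths k n) (g k n)))
    ×
    (∀ (s r : PS) (f g : ℕ → ℕ → ℕ) →
       IsR s r →
       (∀ k n → IsCount (FPaths k n) (f k n)) →
       (∀ k n → IsCount (GPaths k n) (g k n)) →
       (lift (z^ 2) ⊛₂ (lift (cst (+ 1)) ⊖₂ uMono r 1) ⊛₂ (genFun f ⊖₂ lift (cst (+ 1)))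
          ≈₂ uMono r 1 ⊛₂ (uMono (cst (+ 1)) 1 ⊕₂ lift (z^ 1)))
       × (lift (z^ 3) ⊛₂ (lift (cst (+ 1)) ⊖₂ uMono r 1) ⊛₂ (genFun g ⊕₂ lift (cst (+ 1)))
          ≈₂ lift r)
       × (lift (z^ 3) ⊛₂ (lift (cst (+ 1)) ⊖₂ uMono r 1) ⊛₂ (genFun f ⊕₂ genFun g)
          ≈₂ uMono (r ⊛ z^ 1) 2 ⊕₂ uMono (r ⊛ z^ 2) 1 ⊕₂ lift r)
       × ((λ n → + (f 0 n)) ≈ cst (+ 1))
       × (∀ j → z^ 2 ⊛ (λ n → + (f (suc j) n))
                  ≈ (r ⊛ z^ 1 ⊕ cst (+ 1)) ⊛ (r ^ˢ j) ⊖ cst (iv0 j))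
       × (z^ 3 ⊛ (λ n → + (g 0 n)) ≈ r ⊖ z^ 3)
       × (∀ j → z^ 3 ⊛ (λ n → + (g (suc j) n)) ≈ r ^ˢ (suc (suc j))))
theorem1 =
  (Apoly ⊖ mono (+ 2) 3 ⊛ H 0 , H 0 , (λ k n → length (fPaths k n)) , (λ k n → length (gPaths k n)) ,
   root⇒IsR {H 0} (KernelEq-root {H} H-KernelEq) , fPaths-count , gPaths-count) ,
  λ s r f g isR f-count g-count →
    let open ClosedForms.Counted {r} (IsR⇒root {s} {r} isR) f-count g-count in
    F-equation , G-equation , FG-equation , f₀≈1 , z²f-suc , z³g₀ , z³g-suc
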